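{- Let $n, m \ge 1$ be integers, let $S \subseteq S_n$ be a set of permutations containing the identity, and let $G \le S_n$ be the subgroup generated by $S$. If the player can win the $(S, m)$-game, then $|G| = 1$, or $m = 1$, or $(|G|, m) = (p^a, p^b)$ for some prime $p$ and positive integers $a, b$.
   Context: The $(S,m)$-game: $n$ counters lie at positions $1, \dots, n$, each showing an element of $\mathbb{Z}_m$; the initial configuration in $\mathbb{Z}_m^n$ is arbitrary and unknown to the player (who is blindfolded and receives no information). Each turn the player makes a move $y = (y_1, \dots, y_n) \in \mathbb{Z}_m^n$, adding $y_i$ to the counter currently at position $i$; afterwards the counters are permuted by an arbitrary (adversarially chosen) permutation $g \in S$, the counter at position $x$ moving to position $g(x)$. A strategy is a fixed finite sequence of moves. The player "can win" if some finite sequence of moves guarantees that, for every initial configuration and every choice of the permutations from $S$, at some point (initially or after some move) all counters simultaneously show $0$. -}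

module Defs where

open import Data.Nat using (ℕ; zero; suc; _+_; _^_; _≤_; NonZero)
open import Data.Nat.DivMod using (_mod_)
open import Data.Nat.Primality using (Prime)
open import Data.Fin using (Fin; toℕ)
open import Data.Fin.Permutation using (Permutation′; _⟨$⟩ʳ_; _⟨$⟩ˡ_; id; flip; _∘ₚ_)
open import Data.List using (List; []; _∷_; length)
open import Data.List.Membership.Propositional using (_∈_)
open import Data.List.Relation.Unary.All using (All)
open import Data.List.Relation.Unary.AllPairs using (AllPairs)
open import Data.List.Relation.Unary.Any using (Any)
open import Data.Vec using (Vec; []; _∷_)
open import Data.Product using (Σ; _×_; ∃)
open import Data.Sum using (_⊎_)
open import Relation.Binary.PropositionalEquality using (_≡_)
open import Relation.Nullary using (¬_)

_+ₘ_ : ∀ {m} .{{_ : NonZero m}} → Fin m → Fin m → Fin m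
_+ₘ_ {m} a b = (toℕ a + toℕ b) mod m

-- A configuration: the value shown by the counter at each position.
Config : ℕ → ℕ → Set
Config n m = Fin n → Fin m

_≈ₚ_ : ∀ {n} → Permutation′ n → Permutation′ n → Set
g ≈ₚ h = ∀ x → g ⟨$⟩ʳ x ≡ h ⟨$⟩ʳ x

-- One turn: add y_i to the counter at position i, then the counter at
-- position x moves to position g(x). New value at position z is the
-- (updated) value of the counter formerly at position g⁻¹(z).
step : ∀ {n m} .{{_ : NonZero m}} → Config n m → Config n m → Permutation′ n → Config n m
step c y g z = c (g ⟨$⟩ˡ z) +ₘ y (g ⟨$⟩ˡ z)

AllZero : ∀ {n m} → Config n m → Set
AllZero {n} {m} c = (i : Fin n) → toℕ (c i) ≡ 0

ReachesZero : ∀ {n m} .{{_ : NonZero m}} {L : ℕ} →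
              Config n m → Vec (Config n m) L → Vec (Permutation′ n) L → Set
ReachesZero c [] [] = AllZero c
ReachesZero c (y ∷ ys) (g ∷ gs) = AllZero c ⊎ ReachesZero (step c y g) ys gs

AllFrom : ∀ {n L} → List (Permutation′ n) → Vec (Permutation′ n) L → Set
AllFrom S [] = Data.Unit.⊤ where import Data.Unit
AllFrom S (g ∷ gs) = (g ∈ S) × AllFrom S gs

CanWin : ∀ (n m : ℕ) .{{_ : NonZero m}} → List (Permutation′ n) → Set
CanWin n m S =
  Σ ℕ λ L → Σ (Vec (Config n m) L) λ ys →
    (c : Config n m) (gs : Vec (Permutation′ n) L) → AllFrom S gs → ReachesZero c ys gs

data Gen {n : ℕ} (S : List (Permutation′ n)) : Permutation′ n → Set where
  gen  : ∀ {g} → g ∈ S → Gen S g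
  gid  : Gen S id
  gcomp : ∀ {g h} → Gen S g → Gen S h → Gen S (g ∘ₚ h)
  ginv : ∀ {g} → Gen S g → Gen S (flip g)
  gresp : ∀ {g h} → Gen S g → g ≈ₚ h → Gen S h

GenOrder : ∀ {n} → List (Permutation′ n) → ℕ → Set
GenOrder {n} S k =
  Σ (List (Permutation′ n)) λ es →
    (length es ≡ k) ×
    All (Gen S) es ×
    AllPairs (λ g h → ¬ (g ≈ₚ h)) es ×
    (∀ g → Gen S g → Any (λ h → g ≈ₚ h) es)

-- Fix a prime p dividing m and read configurations as vectors in ℤⁿ. Let N 0 consist of the
-- vectors divisible by p and N (j + 1) of the vectors v with v − v∘s ∈ N j for every s ∈ S.
-- An element h ∈ ⟨S⟩ of order q prime to p acts trivially modulo p on every N j: for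
-- v ∈ N (j + 1), d = v − h·v lies in N j, so it is h-invariant mod p by induction, and then
-- 0 = v − hᵠ·v ≡ q·d forces d ≡ 0. Hence if h moves a point x, the indicator of x lies in no N j.
-- As id ∈ S, every configuration outside N (j + 1) has, for any move, a predecessor outside N j
-- (the preimages for the permutations id and s differ by v − v∘s mod p), so running a strategy
-- of length L backwards from that indicator gives a start from which it never clears the board.
-- So if the player can win, ⟨S⟩ has no nontrivial element of order prime to p; by Cauchy's
-- theorem (McKay's proof: rotating q-tuples with product 1) every prime divisor of |⟨S⟩| is p,
-- and as p was any prime divisor of m, |⟨S⟩| and m are powers of the same prime.

module Submission where

open import Defs
open import Data.Nat using (ℕ; _^_; _≤_; NonZero; _≟_)
import Data.Nat.Divisibility as ℕ
open import Data.Nat.Primality using (Prime)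
open import Data.Fin.Permutation using (Permutation′; id; _⟨$⟩ʳ_)
open import Data.List using (List)
open import Data.List.Membership.Propositional using (_∈_)
open import Data.List.Relation.Unary.Any using (Any)
open import Data.List.Relation.Unary.All using (All)
open import Data.List.Relation.Unary.AllPairs using (AllPairs)
open import Data.Product using (Σ; _×_; _,_)
open import Data.Sum using (_⊎_; inj₁; inj₂)
open import Relation.Binary.PropositionalEquality using (_≡_; subst)
open import Relation.Binary.Definitions using (DecidableEquality)
open import Relation.Nullary using (¬_; yes; no)

module Iteration where

  open import Data.Nat using (zero; suc; _+_; _*_; _%_; _/_)
  open import Data.Nat.Properties using (+-comm)
  open import Data.Nat.DivMod using (m≡m%n+[m/n]*n)
  open import Data.Nat.Coprimality using (Coprime; coprime-Bézout)
  open import Data.Nat.GCD using (module Bézout)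
  open import Relation.Binary.PropositionalEquality

  iterate : {A : Set} → (A → A) → ℕ → A → A
  iterate f zero    x = x
  iterate f (suc i) x = f (iterate f i x)

  module _ {A : Set} (f : A → A) where

    iterate-+ : ∀ i j x → iterate f (i + j) x ≡ iterate f i (iterate f j x)
    iterate-+ zero    j x = refl
    iterate-+ (suc i) j x = cong f (iterate-+ i j x)

    iterate-suc′ : ∀ i x → iterate f (suc i) x ≡ iterate f i (f x)
    iterate-suc′ i x = trans (cong (λ k → iterate f k x) (+-comm 1 i)) (iterate-+ i 1 x)

    iterate-fixed : ∀ {x} → f x ≡ x → ∀ i → iterate f i x ≡ x
    iterate-fixed fx≡x zero    = refl
    iterate-fixed fx≡x (suc i) = trans (cong f (iterate-fixed fx≡x i)) fx≡x

    iterate-*-period : ∀ {q x} → iterate f q x ≡ x → ∀ c → iterate f (c * q) x ≡ x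
    iterate-*-period per zero    = refl
    iterate-*-period {q} {x} per (suc c) = begin
      iterate f (q + c * q) x          ≡⟨ iterate-+ q (c * q) x ⟩
      iterate f q (iterate f (c * q) x) ≡⟨ cong (iterate f q) (iterate-*-period per c) ⟩
      iterate f q x                     ≡⟨ per ⟩
      x                                 ∎
      where open ≡-Reasoning

    iterate-%-period : ∀ {q x} .{{_ : NonZero q}} → iterate f q x ≡ x →
                       ∀ i → iterate f i x ≡ iterate f (i % q) x
    iterate-%-period {q} {x} per i = begin
      iterate f i x                                  ≡⟨ cong (λ k → iterate f k x) (m≡m%n+[m/n]*n i q) ⟩
      iterate f (i % q + (i / q) * q) x              ≡⟨ iterate-+ (i % q) ((i / q) * q) x ⟩
      iterate f (i % q) (iterate f ((i / q) * q) x)  ≡⟨ cong (iterate f (i % q)) (iterate-*-period per (i / q)) ⟩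
      iterate f (i % q) x                            ∎
      where open ≡-Reasoning

    fixed-if-coprime-periods : ∀ {a b x} → Coprime a b →
                               iterate f a x ≡ x → iterate f b x ≡ x → f x ≡ x
    fixed-if-coprime-periods {a} {b} {x} a⊥b perᵃ perᵇ with coprime-Bézout a⊥b
    ... | Bézout.+- u v 1+vb≡ua = begin
      f x                          ≡⟨ cong f (sym (iterate-*-period perᵇ v)) ⟩
      iterate f (suc (v * b)) x    ≡⟨ cong (λ k → iterate f k x) 1+vb≡ua ⟩
      iterate f (u * a) x          ≡⟨ iterate-*-period perᵃ u ⟩
      x                            ∎
      where open ≡-Reasoning
    ... | Bézout.-+ u v 1+ua≡vb = begin
      f x                          ≡⟨ cong f (sym (iterate-*-period perᵃ u)) ⟩
      iterate f (suc (u * a)) x    ≡⟨ cong (λ k → iterate f k x) 1+ua≡vb ⟩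
      iterate f (v * b) x          ≡⟨ iterate-*-period perᵇ v ⟩
      x                            ∎
      where open ≡-Reasoning

module Lists where

  open import Data.Nat using (zero; suc; _+_; _*_; s≤s)
  open import Data.Nat.Properties using (+-comm; +-suc)
  open import Data.Fin as Fin using ()
  open import Data.List using ([]; _∷_; length; filter; map; _++_; [_]; replicate; cartesianProductWith; lookup)
  open import Data.List.Properties using (length-++; length-map; ++-assoc; ++-identityʳ; ∷-injective; filter-++)
  open import Data.List.Membership.Propositional.Properties using (∈-filter⁺; ∈-filter⁻; ∈-lookup)
  open import Data.List.Membership.Propositional.Properties.WithK using (unique∧set⇒bag)
  open import Data.List.Relation.Unary.Any using (here; there)
  open import Data.List.Relation.Unary.All as All using ()
  open import Data.List.Relation.Unary.AllPairs as AllPairs using ()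
  open import Data.List.Relation.Unary.Unique.Propositional using (Unique)
  import Data.List.Relation.Unary.Unique.Propositional.Properties as Unique
  open import Data.List.Relation.Binary.BagAndSetEquality using (∼bag⇒↭)
  open import Data.List.Relation.Binary.Permutation.Propositional.Properties using (↭-length)
  open import Data.Product using (∃-syntax)
  open import Data.Empty using (⊥-elim)
  open import Function using (_∘_)
  open import Function.Bundles using (mk⇔)
  open import Level using (0ℓ)
  open import Relation.Nullary using (¬?)
  open import Relation.Unary using (Pred; Decidable)
  open import Relation.Binary.Core using (Rel)
  open import Relation.Binary.Definitions using (Symmetric)
  open import Relation.Binary.PropositionalEquality hiding ([_])
  open Iteration

  module _ {A : Set} where

    length-filter+length-filter-∁ : {P : Pred A 0ℓ} (P? : Decidable P) (xs : List A) →
      length xs ≡ length (filter P? xs) + length (filter (¬? ∘ P?) xs)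
    length-filter+length-filter-∁ P? [] = refl
    length-filter+length-filter-∁ P? (x ∷ xs) with P? x
    ... | yes _ = cong suc (length-filter+length-filter-∁ P? xs)
    ... | no  _ = trans (cong suc (length-filter+length-filter-∁ P? xs)) (sym (+-suc _ _))

    length-≡-by-members : {xs ys : List A} → Unique xs → Unique ys →
      (∀ {z} → z ∈ xs → z ∈ ys) → (∀ {z} → z ∈ ys → z ∈ xs) → length xs ≡ length ys
    length-≡-by-members xs! ys! xs⊆ys ys⊆xs =
      ↭-length (∼bag⇒↭ (unique∧set⇒bag xs! ys! (mk⇔ xs⊆ys ys⊆xs)))

  module _ {A : Set} where

    rotate : List A → List A
    rotate []       = []
    rotate (a ∷ xs) = xs ++ [ a ]

    length-rotate : ∀ xs → length (rotate xs) ≡ length xs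
    length-rotate []       = refl
    length-rotate (a ∷ xs) = trans (length-++ xs) (+-comm (length xs) 1)

    iterate-rotate-++ : ∀ xs ys → iterate rotate (length xs) (xs ++ ys) ≡ ys ++ xs
    iterate-rotate-++ []       ys = sym (++-identityʳ ys)
    iterate-rotate-++ (a ∷ xs) ys = begin
      iterate rotate (suc (length xs)) (a ∷ (xs ++ ys)) ≡⟨ iterate-suc′ rotate (length xs) _ ⟩
      iterate rotate (length xs) ((xs ++ ys) ++ [ a ])
        ≡⟨ cong (iterate rotate (length xs)) (++-assoc xs ys [ a ]) ⟩
      iterate rotate (length xs) (xs ++ (ys ++ [ a ]))  ≡⟨ iterate-rotate-++ xs (ys ++ [ a ]) ⟩
      (ys ++ [ a ]) ++ xs                               ≡⟨ ++-assoc ys [ a ] xs ⟩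
      ys ++ (a ∷ xs)                                    ∎
      where open ≡-Reasoning

    iterate-rotate-length : ∀ xs → iterate rotate (length xs) xs ≡ xs
    iterate-rotate-length xs =
      trans (cong (iterate rotate (length xs)) (sym (++-identityʳ xs))) (iterate-rotate-++ xs [])

    rotate-replicate : ∀ l a → rotate (replicate l a) ≡ replicate l a
    rotate-replicate zero    a = refl
    rotate-replicate (suc l) a = snoc-replicate l
      where
      snoc-replicate : ∀ l → replicate l a ++ [ a ] ≡ a ∷ replicate l a
      snoc-replicate zero    = refl
      snoc-replicate (suc l) = cong (a ∷_) (snoc-replicate l)

    rotate-fixed⇒replicate : ∀ a xs → rotate (a ∷ xs) ≡ a ∷ xs →
                             a ∷ xs ≡ replicate (suc (length xs)) a
    rotate-fixed⇒replicate a xs fixed = cong (a ∷_) (snoc-fixed xs fixed)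
      where
      snoc-fixed : ∀ xs → xs ++ [ a ] ≡ a ∷ xs → xs ≡ replicate (length xs) a
      snoc-fixed []       _  = refl
      snoc-fixed (b ∷ xs) eq with ∷-injective eq
      ... | refl , eq′ = cong (b ∷_) (snoc-fixed xs eq′)

    unique-length≥2⇒∃≢ : DecidableEquality A → ∀ {xs} → Unique xs → 2 ≤ length xs →
                         ∀ e → ∃[ x ] x ∈ xs × x ≢ e
    unique-length≥2⇒∃≢ _≟_ {_ ∷ []}    _ (s≤s ()) _
    unique-length≥2⇒∃≢ _≟_ {a ∷ b ∷ _} ((a≢b All.∷ _) AllPairs.∷ _) _ e with a ≟ e
    ... | yes refl = b , there (here refl) , a≢b ∘ sym
    ... | no a≢e   = a , here refl , a≢e

    length-filter≡1 : {P : Pred A 0ℓ} (P? : Decidable P) {xs : List A} {x : A} →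
                      Unique xs → x ∈ xs → P x → (∀ {y} → y ∈ xs → P y → y ≡ x) →
                      length (filter P? xs) ≡ 1
    length-filter≡1 P? {xs} xs! x∈xs px unique-P =
      length-≡-by-members (Unique.filter⁺ P? {xs} xs!) (All.[] AllPairs.∷ AllPairs.[])
        (λ y∈ → let y∈xs , py = ∈-filter⁻ P? {xs = xs} y∈ in here (unique-P y∈xs py))
        (λ { (here refl) → ∈-filter⁺ P? x∈xs px })

    lookup-injective : {R : Rel A 0ℓ} → Symmetric R → ∀ {xs} → AllPairs (λ x y → ¬ R x y) xs →
                       ∀ i j → R (lookup xs i) (lookup xs j) → i ≡ j
    lookup-injective sym′ (_ AllPairs.∷ _)     Fin.zero    Fin.zero    _ = refl
    lookup-injective sym′ (x≉xs AllPairs.∷ _)  Fin.zero    (Fin.suc j) r =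
      ⊥-elim (All.lookup x≉xs (∈-lookup j) r)
    lookup-injective sym′ (x≉xs AllPairs.∷ _)  (Fin.suc i) Fin.zero    r =
      ⊥-elim (All.lookup x≉xs (∈-lookup i) (sym′ r))
    lookup-injective sym′ (_ AllPairs.∷ xs!)   (Fin.suc i) (Fin.suc j) r =
      cong Fin.suc (lookup-injective sym′ xs! i j r)

  module _ {A B C : Set} (f : A → B → C) where

    length-cartesianProductWith : ∀ xs ys → length (cartesianProductWith f xs ys) ≡ length xs * length ys
    length-cartesianProductWith []       ys = refl
    length-cartesianProductWith (x ∷ xs) ys = trans (length-++ (map (f x) ys))
      (cong₂ _+_ (length-map (f x) ys) (length-cartesianProductWith xs ys))

    length-filter-cartesianProductWith : {P : Pred C 0ℓ} (P? : Decidable P) → ∀ xs ys →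
      (∀ x → length (filter P? (map (f x) ys)) ≡ 1) →
      length (filter P? (cartesianProductWith f xs ys)) ≡ length xs
    length-filter-cartesianProductWith P? []       ys one = refl
    length-filter-cartesianProductWith P? (x ∷ xs) ys one = begin
      length (filter P? (map (f x) ys ++ cartesianProductWith f xs ys))
        ≡⟨ cong length (filter-++ P? (map (f x) ys) _) ⟩
      length (filter P? (map (f x) ys) ++ filter P? (cartesianProductWith f xs ys))
        ≡⟨ length-++ (filter P? (map (f x) ys)) ⟩
      length (filter P? (map (f x) ys)) + length (filter P? (cartesianProductWith f xs ys))
        ≡⟨ cong₂ _+_ (one x) (length-filter-cartesianProductWith P? xs ys one) ⟩
      suc (length xs)
        ∎
      where open ≡-Reasoning

module PrimePeriod {A : Set} (_≟_ : DecidableEquality A) (f : A → A) {q : ℕ} (q-prime : Prime q) where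

  open import Data.Nat using (zero; suc; pred; _+_; _*_; _∸_; _<_; NonZero; >-nonZero; >-nonZero⁻¹)
  open import Data.Nat.Properties
    using (+-comm; +-assoc; +-identityʳ; m∸n+n≡m; <⇒≤; m≤m+n; +-monoʳ-<; +-monoˡ-≤; <-≤-trans; ≤-refl; ≤-pred;
           m<n⇒0<n∸m; suc-pred)
  open import Data.Nat.DivMod using (m%n<n)
  open import Data.Nat.Coprimality using (prime⇒coprime)
  open import Data.Nat.Primality using (prime⇒nonZero)
  open import Data.List using (length; filter; applyUpTo)
  open import Data.List.Properties using (filter-all; length-applyUpTo)
  open import Data.List.Membership.Propositional using (_∉_; find)
  open import Data.List.Membership.Propositional.Properties
    using (∈-filter⁺; ∈-filter⁻; ∈-applyUpTo⁺; ∈-applyUpTo⁻)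
  open import Data.List.Membership.DecPropositional _≟_ using (_∈?_)
  open import Data.List.Relation.Unary.All as All using ()
  open import Data.List.Relation.Unary.All.Properties using (¬All⇒Any¬)
  open import Data.List.Relation.Unary.Unique.Propositional using (Unique)
  import Data.List.Relation.Unary.Unique.Propositional.Properties as Unique
  open import Data.Product using (∃-syntax; proj₁; proj₂)
  open import Function using (_∘_)
  open import Level using (0ℓ)
  open import Relation.Nullary using (¬?)
  open import Relation.Unary using (Pred; Decidable)
  open import Relation.Binary.PropositionalEquality
  open Iteration
  open Lists

  private instance
    q≢0 : NonZero q
    q≢0 = prime⇒nonZero q-prime

  Fixed : Pred A 0ℓ
  Fixed x = f x ≡ x

  fixed? : Decidable Fixed
  fixed? x = f x ≟ x

  Closed : List A → Set
  Closed X = ∀ {x} → x ∈ X → f x ∈ X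

  Periodic : List A → Set
  Periodic X = ∀ {x} → x ∈ X → iterate f q x ≡ x

  iterate-∈ : ∀ {X} → Closed X → ∀ k {x} → x ∈ X → iterate f k x ∈ X
  iterate-∈ X-closed zero    x∈X = x∈X
  iterate-∈ X-closed (suc k) x∈X = X-closed (iterate-∈ X-closed k x∈X)

  module Orbit {x : A} (per : iterate f q x ≡ x) (moved : ¬ Fixed x) where

    orbit : List A
    orbit = applyUpTo (λ i → iterate f i x) q

    orbit-unique : Unique orbit
    orbit-unique = Unique.applyUpTo⁺₁ _ q distinct
      where
      distinct : ∀ {i j} → i < j → j < q → iterate f i x ≢ iterate f j x
      distinct {i} {j} i<j j<q fⁱx≡fʲx =
        moved (fixed-if-coprime-periods f (prime⇒coprime q-prime {{d≢0}} d<q) per fᵈx≡x)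
        where
        d : ℕ
        d = (q ∸ j) + i
        d≢0 : NonZero d
        d≢0 = >-nonZero (<-≤-trans (m<n⇒0<n∸m j<q) (m≤m+n (q ∸ j) i))
        q∸j+j≡q : (q ∸ j) + j ≡ q
        q∸j+j≡q = m∸n+n≡m (<⇒≤ j<q)
        d<q : d < q
        d<q = subst (d <_) q∸j+j≡q (+-monoʳ-< (q ∸ j) i<j)
        fᵈx≡x : iterate f d x ≡ x
        fᵈx≡x = begin
          iterate f ((q ∸ j) + i) x         ≡⟨ iterate-+ f (q ∸ j) i x ⟩
          iterate f (q ∸ j) (iterate f i x) ≡⟨ cong (iterate f (q ∸ j)) fⁱx≡fʲx ⟩
          iterate f (q ∸ j) (iterate f j x) ≡⟨ iterate-+ f (q ∸ j) j x ⟨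
          iterate f ((q ∸ j) + j) x         ≡⟨ cong (λ k → iterate f k x) q∸j+j≡q ⟩
          iterate f q x                     ≡⟨ per ⟩
          x                                 ∎
          where open ≡-Reasoning

    orbit-closed : Closed orbit
    orbit-closed y∈orbit with ∈-applyUpTo⁻ _ y∈orbit
    ... | i , _ , refl = subst (_∈ orbit) (sym (iterate-%-period f per (suc i)))
                                (∈-applyUpTo⁺ _ (m%n<n (suc i) q))

    fixed∉orbit : ∀ {y} → Fixed y → y ∉ orbit
    fixed∉orbit {y} fy≡y y∈orbit with ∈-applyUpTo⁻ _ y∈orbit
    ... | i , i<q , refl = moved (subst Fixed (sym x≡y) fy≡y)
      where
      x≡y : x ≡ iterate f i x
      x≡y = begin
        x                                 ≡⟨ per ⟨
        iterate f q x                     ≡⟨ cong (λ k → iterate f k x) (m∸n+n≡m (<⇒≤ i<q)) ⟨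
        iterate f ((q ∸ i) + i) x         ≡⟨ iterate-+ f (q ∸ i) i x ⟩
        iterate f (q ∸ i) (iterate f i x) ≡⟨ iterate-fixed f fy≡y (q ∸ i) ⟩
        iterate f i x                     ∎
        where open ≡-Reasoning

  module RemoveOrbit {X : List A} (X! : Unique X) (X-closed : Closed X) (X-periodic : Periodic X)
                     {x : A} (x∈X : x ∈ X) (moved : ¬ Fixed x) where

    open Orbit (X-periodic x∈X) moved

    in-orbit? : Decidable (_∈ orbit)
    in-orbit? y = y ∈? orbit

    rest : List A
    rest = filter (¬? ∘ in-orbit?) X

    orbit⊆X : ∀ {y} → y ∈ orbit → y ∈ X
    orbit⊆X y∈orbit with ∈-applyUpTo⁻ _ y∈orbit
    ... | i , _ , refl = iterate-∈ X-closed i x∈X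

    length-X : length X ≡ q + length rest
    length-X = trans (length-filter+length-filter-∁ in-orbit? X)
                     (cong (_+ length rest) (trans length-X∩orbit (length-applyUpTo _ q)))
      where
      length-X∩orbit : length (filter in-orbit? X) ≡ length orbit
      length-X∩orbit = length-≡-by-members (Unique.filter⁺ in-orbit? {X} X!) orbit-unique
        (λ y∈X∩orbit → proj₂ (∈-filter⁻ in-orbit? {xs = X} y∈X∩orbit))
        (λ y∈orbit → ∈-filter⁺ in-orbit? (orbit⊆X y∈orbit) y∈orbit)

    rest-unique : Unique rest
    rest-unique = Unique.filter⁺ (¬? ∘ in-orbit?) {X} X!

    rest-closed : Closed rest
    rest-closed {y} y∈rest with ∈-filter⁻ (¬? ∘ in-orbit?) {xs = X} y∈rest
    ... | y∈X , y∉orbit = ∈-filter⁺ (¬? ∘ in-orbit?) (X-closed y∈X) (y∉orbit ∘ y∈orbit)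
      where
      y≡fᵠ⁻¹fy : y ≡ iterate f (pred q) (f y)
      y≡fᵠ⁻¹fy = begin
        y                           ≡⟨ X-periodic y∈X ⟨
        iterate f q y               ≡⟨ cong (λ k → iterate f k y) (suc-pred q) ⟨
        iterate f (suc (pred q)) y  ≡⟨ iterate-suc′ f (pred q) y ⟩
        iterate f (pred q) (f y)    ∎
        where open ≡-Reasoning
      y∈orbit : f y ∈ orbit → y ∈ orbit
      y∈orbit fy∈orbit = subst (_∈ orbit) (sym y≡fᵠ⁻¹fy) (iterate-∈ orbit-closed (pred q) fy∈orbit)

    rest-periodic : Periodic rest
    rest-periodic y∈rest = X-periodic (proj₁ (∈-filter⁻ (¬? ∘ in-orbit?) {xs = X} y∈rest))

    |rest|<|X| : length rest < length X
    |rest|<|X| = subst (length rest <_) (sym length-X) (+-monoˡ-≤ (length rest) (>-nonZero⁻¹ q))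

    length-fixed-rest : length (filter fixed? rest) ≡ length (filter fixed? X)
    length-fixed-rest =
      length-≡-by-members (Unique.filter⁺ fixed? {rest} rest-unique) (Unique.filter⁺ fixed? {X} X!)
      (λ y∈ → let y∈rest , fy = ∈-filter⁻ fixed? {xs = rest} y∈ in
              ∈-filter⁺ fixed? (proj₁ (∈-filter⁻ (¬? ∘ in-orbit?) {xs = X} y∈rest)) fy)
      (λ y∈ → let y∈X , fy = ∈-filter⁻ fixed? {xs = X} y∈ in
              ∈-filter⁺ fixed? (∈-filter⁺ (¬? ∘ in-orbit?) y∈X (fixed∉orbit fy)) fy)

    add-orbit : ∀ {t} → length rest ≡ length (filter fixed? rest) + t * q →
                length X ≡ length (filter fixed? X) + suc t * q
    add-orbit {t} |rest|≡ = begin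
      length X                                  ≡⟨ length-X ⟩
      q + length rest                           ≡⟨ cong (q +_) |rest|≡ ⟩
      q + (length (filter fixed? rest) + t * q) ≡⟨ cong (λ k → q + (k + t * q)) length-fixed-rest ⟩
      q + (length (filter fixed? X) + t * q)    ≡⟨ +-assoc q _ _ ⟨
      q + length (filter fixed? X) + t * q      ≡⟨ cong (_+ t * q) (+-comm q _) ⟩
      length (filter fixed? X) + q + t * q      ≡⟨ +-assoc (length (filter fixed? X)) q _ ⟩
      length (filter fixed? X) + suc t * q      ∎
      where open ≡-Reasoning

  length≡fixed+t*q : ∀ X → Unique X → Closed X → Periodic X →
                     ∃[ t ] length X ≡ length (filter fixed? X) + t * q
  length≡fixed+t*q X = count (suc (length X)) X ≤-refl
    where
    count : ∀ b X → length X < b → Unique X → Closed X → Periodic X →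
            ∃[ t ] length X ≡ length (filter fixed? X) + t * q
    count (suc b) X |X|<b X! X-closed X-periodic with All.all? fixed? X
    ... | yes all-fixed = 0 , trans (cong length (sym (filter-all fixed? all-fixed))) (sym (+-identityʳ _))
    ... | no ¬all-fixed with find (¬All⇒Any¬ fixed? X ¬all-fixed)
    ...   | x , x∈X , moved =
      let open RemoveOrbit X! X-closed X-periodic x∈X moved
          t , |rest|≡ = count b rest (<-≤-trans |rest|<|X| (≤-pred |X|<b)) rest-unique rest-closed rest-periodic
      in  suc t , add-orbit {t} |rest|≡

module Cauchy {n : ℕ} {S : List (Permutation′ n)} (es : List (Permutation′ n))
              (es⊆⟨S⟩ : All (Gen S) es) (es-distinct : AllPairs (λ g h → ¬ g ≈ₚ h) es)
              (⟨S⟩⊆es : ∀ g → Gen S g → Any (λ h → g ≈ₚ h) es) where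

  open import Data.Nat using (zero; suc; _*_; nonTrivial⇒n>1)
  open import Data.Nat.Properties using (+-comm; ≤-trans)
  open import Data.Nat.Divisibility using (_∣_; ∣m+n∣m⇒∣n; n∣m*n; ∣-trans; ∣⇒≤)
  open import Data.Nat.Primality using (¬prime[0]; ¬prime[1])
  open import Data.Fin as Fin using (Fin)
  open import Data.Fin.Properties using (all?; nonZeroIndex)
  open import Data.Fin.Permutation using (_⟨$⟩ˡ_; _∘ₚ_; inverseˡ; inverseʳ)
  open import Data.List
    using ([]; _∷_; length; filter; map; _++_; [_]; replicate; cartesianProductWith; lookup; allFin)
  open import Data.List.Properties using (≡-dec; ∷-injective; length-replicate; length-tabulate)
  open import Data.List.Membership.Propositional.Properties
    using (∈-map⁺; ∈-map⁻; ∈-filter⁺; ∈-filter⁻; ∈-lookup; ∈-allFin;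
           ∈-cartesianProductWith⁺; ∈-cartesianProductWith⁻)
  open import Data.List.Relation.Unary.Any as Any using (here; there)
  open import Data.List.Relation.Unary.Any.Properties using (lookup-index)
  open import Data.List.Relation.Unary.All as All using ()
  open import Data.List.Relation.Unary.AllPairs as AllPairs using ()
  open import Data.List.Relation.Unary.Unique.Propositional using (Unique)
  import Data.List.Relation.Unary.Unique.Propositional.Properties as Unique
  open import Data.Product using (∃-syntax; proj₁; proj₂)
  open import Data.Empty using (⊥-elim)
  open import Function using (_∘_) renaming (id to idF)
  open import Relation.Unary using (Decidable)
  open import Relation.Binary.PropositionalEquality hiding ([_])
  open Iteration
  open Lists

  K : ℕ
  K = length es

  E : Fin K → Permutation′ n
  E = lookup es

  E∈⟨S⟩ : ∀ a → Gen S (E a)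
  E∈⟨S⟩ a = All.lookup es⊆⟨S⟩ (∈-lookup a)

  E-injective : ∀ {a b} → E a ≈ₚ E b → a ≡ b
  E-injective = lookup-injective (λ g≈h x → sym (g≈h x)) es-distinct _ _

  E-surjective : ∀ {g} → Gen S g → ∃[ a ] g ≈ₚ E a
  E-surjective {g} g∈⟨S⟩ = Any.index (⟨S⟩⊆es g g∈⟨S⟩) , lookup-index (⟨S⟩⊆es g g∈⟨S⟩)

  one : Fin K
  one = proj₁ (E-surjective gid)

  id≈E-one : id ≈ₚ E one
  id≈E-one = proj₂ (E-surjective gid)

  K-nonZero : NonZero K
  K-nonZero = nonZeroIndex one

  Word : Set
  Word = List (Fin K)

  _≟ʷ_ : DecidableEquality Word
  _≟ʷ_ = ≡-dec Fin._≟_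

  eval : Word → Permutation′ n
  eval []      = id
  eval (a ∷ w) = eval w ∘ₚ E a

  eval∈⟨S⟩ : ∀ w → Gen S (eval w)
  eval∈⟨S⟩ []      = gid
  eval∈⟨S⟩ (a ∷ w) = gcomp (eval∈⟨S⟩ w) (E∈⟨S⟩ a)

  eval-++ : ∀ u w x → eval (u ++ w) ⟨$⟩ʳ x ≡ eval u ⟨$⟩ʳ (eval w ⟨$⟩ʳ x)
  eval-++ []      w x = refl
  eval-++ (a ∷ u) w x = cong (E a ⟨$⟩ʳ_) (eval-++ u w x)

  eval-replicate : ∀ l a x → eval (replicate l a) ⟨$⟩ʳ x ≡ iterate (E a ⟨$⟩ʳ_) l x
  eval-replicate zero    a x = refl
  eval-replicate (suc l) a x = cong (E a ⟨$⟩ʳ_) (eval-replicate l a x)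

  Trivial : Word → Set
  Trivial w = ∀ x → eval w ⟨$⟩ʳ x ≡ x

  trivial? : Decidable Trivial
  trivial? w = all? (λ x → eval w ⟨$⟩ʳ x Fin.≟ x)

  trivial-rotate : ∀ w → Trivial w → Trivial (rotate w)
  trivial-rotate []      triv = triv
  trivial-rotate (a ∷ w) triv x = begin
    eval (w ++ [ a ]) ⟨$⟩ʳ x                       ≡⟨ eval-++ w [ a ] x ⟩
    eval w ⟨$⟩ʳ (E a ⟨$⟩ʳ x)                       ≡⟨ inverseˡ (E a) ⟨
    E a ⟨$⟩ˡ (E a ⟨$⟩ʳ (eval w ⟨$⟩ʳ (E a ⟨$⟩ʳ x))) ≡⟨ cong (E a ⟨$⟩ˡ_) (triv _) ⟩
    E a ⟨$⟩ˡ (E a ⟨$⟩ʳ x)                          ≡⟨ inverseˡ (E a) ⟩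
    x                                              ∎
    where open ≡-Reasoning

  words : ℕ → List Word
  words zero    = [ [] ]
  words (suc l) = cartesianProductWith (λ w a → a ∷ w) (words l) (allFin K)

  ∈-words⁺ : ∀ w → w ∈ words (length w)
  ∈-words⁺ []      = here refl
  ∈-words⁺ (a ∷ w) = ∈-cartesianProductWith⁺ (λ w a → a ∷ w) (∈-words⁺ w) (∈-allFin a)

  ∈-words⁻ : ∀ l {w} → w ∈ words l → length w ≡ l
  ∈-words⁻ zero    (here refl) = refl
  ∈-words⁻ (suc l) w∈ with ∈-cartesianProductWith⁻ (λ w a → a ∷ w) (words l) (allFin K) w∈
  ... | _ , _ , w′∈ , _ , refl = cong suc (∈-words⁻ l w′∈)

  words-unique : ∀ l → Unique (words l)
  words-unique zero    = All.[] AllPairs.∷ AllPairs.[]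
  words-unique (suc l) = Unique.cartesianProductWith⁺ (λ w a → a ∷ w)
    (λ eq → let a≡b , w≡w′ = ∷-injective eq in w≡w′ , a≡b) (words-unique l) (Unique.allFin⁺ K)

  completion : ∀ w → ∃[ a ] Trivial (a ∷ w) × (∀ b → Trivial (b ∷ w) → b ≡ a)
  completion w with E-surjective (ginv (eval∈⟨S⟩ w))
  ... | a , w⁻¹≈Eₐ = a , triv , unique
    where
    triv : Trivial (a ∷ w)
    triv x = trans (sym (w⁻¹≈Eₐ (eval w ⟨$⟩ʳ x))) (inverseˡ (eval w))
    unique : ∀ b → Trivial (b ∷ w) → b ≡ a
    unique b triv′ = E-injective λ y →
      trans (cong (E b ⟨$⟩ʳ_) (sym (inverseʳ (eval w)))) (trans (triv′ (eval w ⟨$⟩ˡ y)) (w⁻¹≈Eₐ y))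

  length-trivial-words : ∀ l → length (filter trivial? (words (suc l))) ≡ length (words l)
  length-trivial-words l =
    length-filter-cartesianProductWith (λ w a → a ∷ w) trivial? (words l) (allFin K) exactly-one
    where
    exactly-one : ∀ w → length (filter trivial? (map (_∷ w) (allFin K))) ≡ 1
    exactly-one w with completion w
    ... | a , triv , unique = length-filter≡1 trivial? (Unique.map⁺ (proj₁ ∘ ∷-injective) (Unique.allFin⁺ K))
      (∈-map⁺ (_∷ w) (∈-allFin a)) triv
      (λ b∷w∈ triv′ → let b , _ , eq = ∈-map⁻ (_∷ w) b∷w∈ in
         trans eq (cong (_∷ w) (unique b (subst Trivial eq triv′))))

  module McKay {r : ℕ} (q-prime : Prime (suc (suc r))) where

    q : ℕ
    q = suc (suc r)

    open PrimePeriod _≟ʷ_ rotate q-prime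

    X : List Word
    X = filter trivial? (words q)

    ∈X⁻ : ∀ {w} → w ∈ X → w ∈ words q × Trivial w
    ∈X⁻ = ∈-filter⁻ trivial? {xs = words q}

    X-unique : Unique X
    X-unique = Unique.filter⁺ trivial? {words q} (words-unique q)

    X-closed : Closed X
    X-closed {w} w∈X with ∈X⁻ w∈X
    ... | w∈words , triv = ∈-filter⁺ trivial?
      (subst (λ l → rotate w ∈ words l) (trans (length-rotate w) (∈-words⁻ q w∈words))
             (∈-words⁺ (rotate w)))
      (trivial-rotate w triv)

    X-periodic : Periodic X
    X-periodic {w} w∈X =
      subst (λ l → iterate rotate l w ≡ w) (∈-words⁻ q (proj₁ (∈X⁻ w∈X))) (iterate-rotate-length w)

    length-X : length X ≡ length (words r) * K
    length-X = trans (length-trivial-words (suc r))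
      (trans (length-cartesianProductWith (λ w a → a ∷ w) (words r) (allFin K))
             (cong (length (words r) *_) (length-tabulate {n = K} idF)))

    Fix : List Word
    Fix = filter fixed? X

    Fix-unique : Unique Fix
    Fix-unique = Unique.filter⁺ fixed? {X} X-unique

    q∣|Fix| : q ∣ K → q ∣ length Fix
    q∣|Fix| q∣K with length≡fixed+t*q X X-unique X-closed X-periodic
    ... | t , |X|≡ =
      ∣m+n∣m⇒∣n (subst (q ∣_) (trans |X|≡ (+-comm (length Fix) (t * q))) q∣|X|) (n∣m*n t)
      where
      q∣|X| : q ∣ length X
      q∣|X| = subst (q ∣_) (sym length-X) (∣-trans q∣K (n∣m*n (length (words r))))

    ε : Word
    ε = replicate q one

    ε∈Fix : ε ∈ Fix
    ε∈Fix = ∈-filter⁺ fixed?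
      (∈-filter⁺ trivial? (subst (λ l → ε ∈ words l) (length-replicate q) (∈-words⁺ ε))
        (λ x → trans (eval-replicate q one x) (iterate-fixed (E one ⟨$⟩ʳ_) (sym (id≈E-one x)) q)))
      (rotate-replicate q one)

    2≤|Fix| : q ∣ K → 2 ≤ length Fix
    2≤|Fix| q∣K = ≤-trans (nonTrivial⇒n>1 q) (∣⇒≤ {{nonEmpty ε∈Fix}} (q∣|Fix| q∣K))
      where
      nonEmpty : ∀ {xs : List Word} {x} → x ∈ xs → NonZero (length xs)
      nonEmpty (here _)  = _
      nonEmpty (there _) = _

    fixed-word⇒element-of-order-q : ∀ {w} → w ∈ Fix → w ≢ ε →
      ∃[ a ] (∀ x → iterate (E a ⟨$⟩ʳ_) q x ≡ x) × ¬ (∀ x → E a ⟨$⟩ʳ x ≡ x)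
    fixed-word⇒element-of-order-q {w} w∈Fix w≢ε with ∈-filter⁻ fixed? {xs = X} w∈Fix
    ... | w∈X , rotate-w≡w with ∈X⁻ w∈X
    ... | w∈words , triv with w | ∈-words⁻ q w∈words
    ... | a ∷ w′ | |w|≡q = a , period , nontrivial
      where
      w≡aᵠ : a ∷ w′ ≡ replicate q a
      w≡aᵠ = trans (rotate-fixed⇒replicate a w′ rotate-w≡w) (cong (λ l → replicate l a) |w|≡q)
      period : ∀ x → iterate (E a ⟨$⟩ʳ_) q x ≡ x
      period x = trans (sym (eval-replicate q a x)) (subst (λ u → eval u ⟨$⟩ʳ x ≡ x) w≡aᵠ (triv x))
      nontrivial : ¬ (∀ x → E a ⟨$⟩ʳ x ≡ x)
      nontrivial Eₐ≈id =
        w≢ε (trans w≡aᵠ (cong (replicate q) (E-injective (λ x → trans (Eₐ≈id x) (id≈E-one x)))))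

  cauchy : ∀ {q} → Prime q → q ∣ K →
           ∃[ a ] (∀ x → iterate (E a ⟨$⟩ʳ_) q x ≡ x) × ¬ (∀ x → E a ⟨$⟩ʳ x ≡ x)
  cauchy {zero}          0-prime _ = ⊥-elim (¬prime[0] 0-prime)
  cauchy {suc zero}      1-prime _ = ⊥-elim (¬prime[1] 1-prime)
  cauchy {suc (suc r)} q-prime q∣K with unique-length≥2⇒∃≢ _≟ʷ_ Fix-unique (2≤|Fix| q∣K) ε
    where open McKay q-prime
  ... | w , w∈Fix , w≢ε = fixed-word⇒element-of-order-q w∈Fix w≢ε
    where open McKay q-prime

module Filtration {n : ℕ} (S : List (Permutation′ n)) {p : ℕ} (p-prime : Prime p) where

  open import Data.Nat using (zero; suc)
  open import Data.Nat.Primality using (euclidsLemma; ¬prime[1])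
  open import Data.Integer using (ℤ; +_; _+_; _-_; _*_; -_; ∣_∣)
  open import Data.Integer.Properties using (abs-*)
  open import Data.Integer.Divisibility.Signed
    using (_∣_; _∣?_; ∣m∣n⇒∣m+n; ∣m⇒∣-m; ∣m∣n⇒∣m-n; ∣ᵤ⇒∣; ∣⇒∣ᵤ)
  open import Data.Integer.Tactic.RingSolver using (solve-∀)
  open import Data.Fin using (Fin)
  open import Data.Fin.Properties using (all?)
  open import Data.Fin.Permutation using (_⟨$⟩ʳ_; _⟨$⟩ˡ_; flip; inverseˡ; inverseʳ)
  open import Data.List.Relation.Unary.All as All using ()
  open import Data.Empty using (⊥-elim)
  open import Relation.Unary using (Decidable)
  open import Relation.Binary.PropositionalEquality
  open Iteration

  ≈ₚ⇒⟨$⟩ˡ : ∀ {n} {g h : Permutation′ n} → g ≈ₚ h → ∀ i → g ⟨$⟩ˡ i ≡ h ⟨$⟩ˡ i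
  ≈ₚ⇒⟨$⟩ˡ {g = g} {h} g≈h i = begin
    g ⟨$⟩ˡ i                   ≡⟨ inverseˡ h ⟨
    h ⟨$⟩ˡ (h ⟨$⟩ʳ (g ⟨$⟩ˡ i)) ≡⟨ cong (h ⟨$⟩ˡ_) (g≈h (g ⟨$⟩ˡ i)) ⟨
    h ⟨$⟩ˡ (g ⟨$⟩ʳ (g ⟨$⟩ˡ i)) ≡⟨ cong (h ⟨$⟩ˡ_) (inverseʳ g) ⟩
    h ⟨$⟩ˡ i                   ∎
    where open ≡-Reasoning

  Vector : Set
  Vector = Fin n → ℤ

  infixl 6 _⊕_ _⊖_
  infixr 7 _·_

  _⊕_ : Vector → Vector → Vector
  (v ⊕ w) i = v i + w i

  _⊖_ : Vector → Vector → Vector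
  (v ⊖ w) i = v i - w i

  ⊝_ : Vector → Vector
  (⊝ v) i = - v i

  _·_ : Permutation′ n → Vector → Vector
  (g · v) i = v (g ⟨$⟩ˡ i)

  0⃗ : Vector
  0⃗ _ = + 0

  N₀ : Vector → Set
  N₀ v = ∀ i → + p ∣ v i

  N : ℕ → Vector → Set
  N zero    v = N₀ v
  N (suc j) v = All (λ s → N j (v ⊖ flip s · v)) S

  N? : ∀ j → Decidable (N j)
  N? zero    v = all? (λ i → + p ∣? v i)
  N? (suc j) v = All.all? (λ s → N? j (v ⊖ flip s · v)) S

  antisym : ∀ a b → a - b ≡ - (b - a)
  antisym = solve-∀

  self-cancel : ∀ a → + 0 ≡ a - a
  self-cancel = solve-∀

  p∣0 : + p ∣ + 0
  p∣0 = ∣ᵤ⇒∣ (p ℕ.∣0)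

  p∣q*x⇒p∣x : ∀ {q x} → ¬ p ℕ.∣ q → + p ∣ + q * x → + p ∣ x
  p∣q*x⇒p∣x {q} {x} p∤q p∣qx
    with euclidsLemma q ∣ x ∣ p-prime (subst (p ℕ.∣_) (abs-* (+ q) x) (∣⇒∣ᵤ p∣qx))
  ... | inj₁ p∣q = ⊥-elim (p∤q p∣q)
  ... | inj₂ p∣x = ∣ᵤ⇒∣ p∣x

  N-cong : ∀ j {v w} → v ≗ w → N j v → N j w
  N-cong zero    v≗w v∈N = λ i → subst (+ p ∣_) (v≗w i) (v∈N i)
  N-cong (suc j) v≗w v∈N = All.map (N-cong j (λ i → cong₂ _-_ (v≗w i) (v≗w _))) v∈N

  N-⊕ : ∀ j {v w} → N j v → N j w → N j (v ⊕ w)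
  N-⊕ zero    v∈N w∈N i = ∣m∣n⇒∣m+n (v∈N i) (w∈N i)
  N-⊕ (suc j) {v} {w} v∈N w∈N = All.zipWith
    (λ (v′∈N , w′∈N) → N-cong j (λ i → sym (interchange (v i) (w i) _ _)) (N-⊕ j v′∈N w′∈N))
    (v∈N , w∈N)
    where
    interchange : ∀ a b c d → (a + b) - (c + d) ≡ (a - c) + (b - d)
    interchange = solve-∀

  N-⊝ : ∀ j {v} → N j v → N j (⊝ v)
  N-⊝ zero    v∈N i = ∣m⇒∣-m (v∈N i)
  N-⊝ (suc j) {v} v∈N = All.map (λ v′∈N → N-cong j (λ i → sym (neg-distrib (v i) _)) (N-⊝ j v′∈N)) v∈N
    where
    neg-distrib : ∀ a b → (- a) - (- b) ≡ - (a - b)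
    neg-distrib = solve-∀

  N-⊖ : ∀ j {v w} → N j v → N j w → N j (v ⊖ w)
  N-⊖ j {v} {w} v∈N w∈N = N-cong j (λ i → +-neg (v i) (w i)) (N-⊕ j v∈N (N-⊝ j w∈N))
    where
    +-neg : ∀ a b → a + (- b) ≡ a - b
    +-neg = solve-∀

  N₀⊆N : ∀ j {v} → N₀ v → N j v
  N₀⊆N zero    v∈N₀ = v∈N₀
  N₀⊆N (suc j) v∈N₀ =
    All.tabulate λ {s} _ → N₀⊆N j (λ i → ∣m∣n⇒∣m-n (v∈N₀ i) (v∈N₀ (s ⟨$⟩ʳ i)))

  N-resp-N₀ : ∀ j {v w} → N j v → N₀ (w ⊖ v) → N j w
  N-resp-N₀ j {v} {w} v∈N w-v∈N₀ = N-cong j (λ i → cancel (v i) (w i)) (N-⊕ j v∈N (N₀⊆N j w-v∈N₀))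
    where
    cancel : ∀ a b → a + (b - a) ≡ b
    cancel = solve-∀

  mutual
    N-· : ∀ j {g v} → Gen S g → N j v → N j (g · v)
    N-· zero    {g} _ v∈N i = v∈N (g ⟨$⟩ˡ i)
    N-· (suc j) {g} {v} g∈G v∈N = All.tabulate λ {s} s∈S →
      N-cong j (λ i → sym (telescope (v i) (v (g ⟨$⟩ˡ i)) (v (s ⟨$⟩ʳ i)) (v (g ⟨$⟩ˡ (s ⟨$⟩ʳ i)))))
        (N-⊕ j (N-⊕ j (N-⊝ j (N-δ j {v = v} g∈G v∈N)) (All.lookup v∈N s∈S))
               (N-· j (ginv (gen s∈S)) (N-δ j {v = v} g∈G v∈N)))
      where
      telescope : ∀ a b c d → b - d ≡ (- (a - b) + (a - c)) + (c - d)
      telescope = solve-∀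

    N-δ : ∀ j {g v} → Gen S g → N (suc j) v → N j (v ⊖ g · v)
    N-δ j {v = v} (gen {s} s∈S) v∈N =
      N-cong j {⊝ (s · (v ⊖ flip s · v))}
        (λ i → trans (cong (λ x → - (v (s ⟨$⟩ˡ i) - v x)) (inverseʳ s))
                     (sym (antisym (v i) (v (s ⟨$⟩ˡ i)))))
        (N-⊝ j (N-· j (gen s∈S) (All.lookup v∈N s∈S)))
    N-δ j {v = v} gid v∈N = N-cong j {0⃗} (λ i → self-cancel (v i)) (N₀⊆N j (λ _ → p∣0))
    N-δ j {v = v} (gcomp {g} {h} g∈G h∈G) v∈N =
      N-cong j {(v ⊖ h · v) ⊕ h · (v ⊖ g · v)}
        (λ i → sym (split (v i) (v (h ⟨$⟩ˡ i)) (v (g ⟨$⟩ˡ (h ⟨$⟩ˡ i)))))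
        (N-⊕ j (N-δ j {v = v} h∈G v∈N) (N-· j h∈G (N-δ j {v = v} g∈G v∈N)))
      where
      split : ∀ a b c → a - c ≡ (a - b) + (b - c)
      split = solve-∀
    N-δ j {v = v} (ginv {g} g∈G) v∈N =
      N-cong j {⊝ (flip g · (v ⊖ g · v))}
        (λ i → trans (cong (λ x → - (v (g ⟨$⟩ʳ i) - v x)) (inverseˡ g))
                     (sym (antisym (v i) (v (g ⟨$⟩ʳ i)))))
        (N-⊝ j (N-· j (ginv g∈G) (N-δ j {v = v} g∈G v∈N)))
    N-δ j {v = v} (gresp {g} {h} g∈G g≈h) v∈N =
      N-cong j {v ⊖ g · v} (λ i → cong (λ x → v i - v x) (≈ₚ⇒⟨$⟩ˡ {g = g} {h} g≈h i))
        (N-δ j {v = v} g∈G v∈N)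

  module CoprimeOrder {h} (h∈G : Gen S h) {q} (period : ∀ i → iterate (h ⟨$⟩ˡ_) q i ≡ i)
                      (p∤q : ¬ p ℕ.∣ q) where

    hⁱ : ℕ → Fin n → Fin n
    hⁱ = iterate (h ⟨$⟩ˡ_)

    invariant-iterate : ∀ {d} → N₀ (d ⊖ h · d) → ∀ k i → + p ∣ d (hⁱ k i) - d i
    invariant-iterate {d} d-invariant zero    i = subst (+ p ∣_) (self-cancel (d i)) p∣0
    invariant-iterate {d} d-invariant (suc k) i =
      subst (+ p ∣_) (sym (split (d (hⁱ (suc k) i)) (d (hⁱ k i)) (d i)))
        (∣m∣n⇒∣m+n (subst (+ p ∣_) (sym (antisym (d (hⁱ (suc k) i)) (d (hⁱ k i))))
                      (∣m⇒∣-m (d-invariant (hⁱ k i))))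
                   (invariant-iterate {d} d-invariant k i))
      where
      split : ∀ a b c → a - c ≡ (a - b) + (b - c)
      split = solve-∀

    telescope : ∀ {v} → N₀ ((v ⊖ h · v) ⊖ h · (v ⊖ h · v)) →
                ∀ k i → + p ∣ (v i - v (hⁱ k i)) - + k * (v ⊖ h · v) i
    telescope {v} d-invariant zero    i = subst (+ p ∣_) (vanish (v i) (v i - v (h ⟨$⟩ˡ i))) p∣0
      where
      vanish : ∀ a x → + 0 ≡ (a - a) - + 0 * x
      vanish = solve-∀
    telescope {v} d-invariant (suc k) i =
      subst (+ p ∣_) (shift (v i) (v (hⁱ k i)) (v (hⁱ (suc k) i)) (+ k) ((v ⊖ h · v) i))
        (∣m∣n⇒∣m+n (telescope {v} d-invariant k i) (invariant-iterate {v ⊖ h · v} d-invariant k i))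
      where
      shift : ∀ a b c k x → ((a - b) - k * x) + ((b - c) - x) ≡ (a - c) - (+ 1 + k) * x
      shift = solve-∀

    acts-trivially : ∀ j {v} → N j v → N₀ (v ⊖ h · v)
    acts-trivially zero    v∈N i = ∣m∣n⇒∣m-n (v∈N i) (v∈N (h ⟨$⟩ˡ i))
    acts-trivially (suc j) {v} v∈N i =
      p∣q*x⇒p∣x p∤q (subst (+ p ∣_) q*d≡ (∣m⇒∣-m (telescope {v} d-invariant q i)))
      where
      d-invariant : N₀ ((v ⊖ h · v) ⊖ h · (v ⊖ h · v))
      d-invariant = acts-trivially j (N-δ j {v = v} h∈G v∈N)
      cancel : ∀ a x → - ((a - a) - x) ≡ x
      cancel = solve-∀
      q*d≡ : - ((v i - v (hⁱ q i)) - + q * (v ⊖ h · v) i) ≡ + q * (v ⊖ h · v) i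
      q*d≡ = trans (cong (λ x → - ((v i - v x) - + q * (v ⊖ h · v) i)) (period i)) (cancel (v i) _)

    jump∉N : ∀ j {v i} → v i - v (h ⟨$⟩ˡ i) ≡ + 1 → ¬ N j v
    jump∉N j {v} {i} jump v∈N =
      ¬prime[1] (subst Prime (ℕ.∣1⇒≡1 (∣⇒∣ᵤ (subst (+ p ∣_) jump (acts-trivially j v∈N i)))) p-prime)

module ModularArithmetic {m : ℕ} .{{_ : NonZero m}} where

  open import Data.Nat as ℕ using (_%_; _/_; _∸_)
  import Data.Nat.Properties as ℕ
  open import Data.Nat.DivMod using (_mod_; m%n<n; m≡m%n+[m/n]*n; %-distribˡ-+; [m+n]%n≡m%n; m<n⇒m%n≡m)
  open import Data.Integer using (+_; _+_; _-_)
  open import Data.Integer.Properties using (pos-+)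
  open import Data.Integer.Divisibility.Signed using (_∣_; ∣ᵤ⇒∣)
  open import Data.Integer.Tactic.RingSolver using (solve-∀)
  open import Data.Fin using (Fin; toℕ)
  open import Data.Fin.Properties using (toℕ-fromℕ<; toℕ-injective; toℕ<n; toℕ≤n)
  open import Relation.Binary.PropositionalEquality

  _-ₘ_ : Fin m → Fin m → Fin m
  a -ₘ b = (toℕ a ℕ.+ (m ∸ toℕ b)) mod m

  -ₘ-+ₘ : ∀ a b → (a -ₘ b) +ₘ b ≡ a
  -ₘ-+ₘ a b = toℕ-injective (begin
    toℕ ((a -ₘ b) +ₘ b)                      ≡⟨ toℕ-fromℕ< _ ⟩
    (toℕ (a -ₘ b) ℕ.+ toℕ b) % m              ≡⟨ cong (λ t → (t ℕ.+ toℕ b) % m) (toℕ-fromℕ< _) ⟩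
    (u % m ℕ.+ toℕ b) % m                     ≡⟨ cong (λ t → (u % m ℕ.+ t) % m) (m<n⇒m%n≡m (toℕ<n b)) ⟨
    (u % m ℕ.+ toℕ b % m) % m                 ≡⟨ %-distribˡ-+ u (toℕ b) m ⟨
    (u ℕ.+ toℕ b) % m                         ≡⟨ cong (_% m) (ℕ.+-assoc (toℕ a) _ _) ⟩
    (toℕ a ℕ.+ ((m ∸ toℕ b) ℕ.+ toℕ b)) % m  ≡⟨ cong (λ t → (toℕ a ℕ.+ t) % m) (ℕ.m∸n+n≡m (toℕ≤n b)) ⟩
    (toℕ a ℕ.+ m) % m                          ≡⟨ [m+n]%n≡m%n (toℕ a) m ⟩
    toℕ a % m                                  ≡⟨ m<n⇒m%n≡m (toℕ<n a) ⟩
    toℕ a                                      ∎)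
    where
    open ≡-Reasoning
    u : ℕ
    u = toℕ a ℕ.+ (m ∸ toℕ b)

  module _ {d : ℕ} (d∣m : d ℕ.∣ m) where

    ∣-%-residue : ∀ u → + d ∣ + u - + (u % m)
    ∣-%-residue u = subst (+ d ∣_) eq (∣ᵤ⇒∣ (ℕ.∣-trans d∣m (ℕ.n∣m*n (u / m))))
      where
      eq : + ((u / m) ℕ.* m) ≡ + u - + (u % m)
      eq = begin
        + ((u / m) ℕ.* m)                             ≡⟨ cancel (+ (u % m)) _ ⟨
        (+ (u % m) + + ((u / m) ℕ.* m)) - + (u % m)   ≡⟨ cong (_- + (u % m)) (pos-+ (u % m) _) ⟨
        + (u % m ℕ.+ (u / m) ℕ.* m) - + (u % m)       ≡⟨ cong (λ t → + t - + (u % m)) (m≡m%n+[m/n]*n u m) ⟨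
        + u - + (u % m)                               ∎
        where
        open ≡-Reasoning
        cancel : ∀ a b → (a + b) - a ≡ b
        cancel = solve-∀

    ∣-toℕ-+ₘ : ∀ a b → + d ∣ (+ toℕ a + + toℕ b) - + toℕ (a +ₘ b)
    ∣-toℕ-+ₘ a b = subst (+ d ∣_)
      (cong₂ (λ x y → x - + y) (pos-+ (toℕ a) (toℕ b)) (sym (toℕ-fromℕ< (m%n<n (toℕ a ℕ.+ toℕ b) m))))
      (∣-%-residue (toℕ a ℕ.+ toℕ b))

    ∣-toℕ--ₘ : ∀ a b → + d ∣ + toℕ (a -ₘ b) - (+ toℕ a - + toℕ b)
    ∣-toℕ--ₘ a b = subst (+ d ∣_)
      (trans (cong (λ c → (+ toℕ (a -ₘ b) + + toℕ b) - + toℕ c) (-ₘ-+ₘ a b))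
             (rearrange (+ toℕ (a -ₘ b)) (+ toℕ b) (+ toℕ a)))
      (∣-toℕ-+ₘ (a -ₘ b) b)
      where
      rearrange : ∀ c b a → (c + b) - a ≡ c - (a - b)
      rearrange = solve-∀

module Adversary {n m : ℕ} .{{_ : NonZero m}} (S : List (Permutation′ n))
                 {p : ℕ} (p-prime : Prime p) (p∣m : p ℕ.∣ m)
                 {g₀ : Permutation′ n} (g₀∈S : g₀ ∈ S) (g₀≈id : ∀ i → g₀ ⟨$⟩ʳ i ≡ i) where

  open import Data.Nat as ℕ using (suc)
  import Data.Nat.Properties as ℕ
  open import Data.Integer using (ℤ; +_; _+_; _-_; -_)
  open import Data.Integer.Divisibility.Signed using (_∣_; ∣m∣n⇒∣m+n; ∣m⇒∣-m)
  open import Data.Integer.Tactic.RingSolver using (solve-∀)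
  open import Data.Fin using (toℕ)
  open import Data.Fin.Permutation using (_⟨$⟩ˡ_; flip; inverseʳ)
  open import Data.List.Membership.Propositional using (find)
  open import Data.List.Relation.Unary.All.Properties using (¬All⇒Any¬)
  open import Data.Vec using (Vec; []; _∷_)
  open import Data.Product using (∃-syntax)
  open import Function using (_∘_)
  open import Relation.Binary.PropositionalEquality
  open ModularArithmetic

  open Filtration S p-prime

  ι : Config n m → Vector
  ι c i = + toℕ (c i)

  AllZero⇒N : ∀ j {c : Config n m} → AllZero c → N j (ι c)
  AllZero⇒N j c≡0 = N₀⊆N j λ i → subst (λ t → + p ∣ + t) (sym (c≡0 i)) p∣0

  ReachesZero-cong : ∀ {L} {c c′ : Config n m} (ys : Vec (Config n m) L) gs → c ≗ c′ →
                     ReachesZero c ys gs → ReachesZero c′ ys gs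
  ReachesZero-cong []       []       c≗c′ c≡0 i = trans (cong toℕ (sym (c≗c′ i))) (c≡0 i)
  ReachesZero-cong (y ∷ ys) (g ∷ gs) c≗c′ (inj₁ c≡0) =
    inj₁ λ i → trans (cong toℕ (sym (c≗c′ i))) (c≡0 i)
  ReachesZero-cong (y ∷ ys) (g ∷ gs) c≗c′ (inj₂ later) =
    inj₂ (ReachesZero-cong ys gs (λ i → cong (_+ₘ y (g ⟨$⟩ˡ i)) (c≗c′ (g ⟨$⟩ˡ i))) later)

  preimage : Config n m → Config n m → Permutation′ n → Config n m
  preimage y c₁ g i = c₁ (g ⟨$⟩ʳ i) -ₘ y i

  step-preimage : ∀ y c₁ g → step (preimage y c₁ g) y g ≗ c₁
  step-preimage y c₁ g i = trans (-ₘ-+ₘ _ _) (cong c₁ (inverseʳ g))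

  preimage-difference : ∀ y c₁ s →
    N₀ ((ι c₁ ⊖ flip s · ι c₁) ⊖ (ι (preimage y c₁ g₀) ⊖ ι (preimage y c₁ s)))
  preimage-difference y c₁ s i = subst (+ p ∣_) eq
    (∣m∣n⇒∣m+n (∣m⇒∣-m (∣-toℕ--ₘ p∣m (c₁ (g₀ ⟨$⟩ʳ i)) (y i)))
               (∣-toℕ--ₘ p∣m (c₁ (s ⟨$⟩ʳ i)) (y i)))
    where
    x₀ xₛ : ℤ
    x₀ = ι (preimage y c₁ g₀) i
    xₛ = ι (preimage y c₁ s) i
    rearrange : ∀ a b u v w → - (u - (a - w)) + (v - (b - w)) ≡ (a - b) - (u - v)
    rearrange = solve-∀
    eq : - (x₀ - (ι c₁ (g₀ ⟨$⟩ʳ i) - ι y i)) + (xₛ - (ι c₁ (s ⟨$⟩ʳ i) - ι y i))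
       ≡ (ι c₁ i - ι c₁ (s ⟨$⟩ʳ i)) - (x₀ - xₛ)
    eq = trans (cong (λ k → - (x₀ - (ι c₁ k - ι y i)) + (xₛ - (ι c₁ (s ⟨$⟩ʳ i) - ι y i))) (g₀≈id i))
               (rearrange (ι c₁ i) (ι c₁ (s ⟨$⟩ʳ i)) x₀ xₛ (ι y i))

  predecessor : ∀ j (y c₁ : Config n m) → ¬ N (suc j) (ι c₁) →
                ∃[ g ] ∃[ c ] g ∈ S × step c y g ≗ c₁ × ¬ N j (ι c)
  predecessor j y c₁ c₁∉N with N? j (ι (preimage y c₁ g₀))
  ... | no  c₀∉N = g₀ , preimage y c₁ g₀ , g₀∈S , step-preimage y c₁ g₀ , c₀∉N
  ... | yes c₀∈N with find (¬All⇒Any¬ (λ s → N? j (ι c₁ ⊖ flip s · ι c₁)) S c₁∉N)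
  ...   | s , s∈S , δ∉N = s , preimage y c₁ s , s∈S , step-preimage y c₁ s ,
    λ cₛ∈N → δ∉N (N-resp-N₀ j (N-⊖ j c₀∈N cₛ∈N) (preimage-difference y c₁ s))

  -- Built backwards: c is the configuration after the last move.
  adversary : ∀ {L} (ys : Vec (Config n m) L) j (c : Config n m) → ¬ N (j ℕ.+ L) (ι c) →
              ∃[ c₀ ] ∃[ gs ] AllFrom S gs × ¬ N j (ι c₀) × ¬ ReachesZero c₀ ys gs
  adversary [] j c c∉N = c , [] , _ , c∉N′ , c∉N′ ∘ AllZero⇒N j
    where
    c∉N′ : ¬ N j (ι c)
    c∉N′ = subst (λ k → ¬ N k (ι c)) (ℕ.+-identityʳ j) c∉N
  adversary (y ∷ ys) j c c∉N with adversary ys (suc j) c (subst (λ k → ¬ N k (ι c)) (ℕ.+-suc j _) c∉N)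
  ... | c₁ , gs , gs∈S , c₁∉N , c₁-loses with predecessor j y c₁ c₁∉N
  ...   | g , c₀ , g∈S , step≗c₁ , c₀∉N = c₀ , g ∷ gs , (g∈S , gs∈S) , c₀∉N , λ where
    (inj₁ c₀≡0)  → c₀∉N (AllZero⇒N j c₀≡0)
    (inj₂ later) → c₁-loses (ReachesZero-cong ys gs step≗c₁ later)

module PrimePowers where

  open import Data.Nat using (zero; suc; _*_; s≤s; z≤n)
  open import Data.Nat.Divisibility using (_∣_; m∣m*n; n∣m*n; ∣-trans)
  open import Data.Nat.Primality.Factorisation using (factorise; PrimeFactorisation)
  open import Data.Nat.ListAction using (product)
  open import Data.List using ([]; _∷_; length)
  open import Data.List.Relation.Unary.All as All using ([]; _∷_)
  open import Data.Product using (∃-syntax)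
  open import Data.Empty using (⊥-elim)
  open import Function using (_∘_; flip)
  open import Relation.Binary.PropositionalEquality

  product-≡-power : ∀ {p xs} → All (_≡ p) xs → product xs ≡ p ^ length xs
  product-≡-power []            = refl
  product-≡-power {p} (refl ∷ xs≡p) = cong (p *_) (product-≡-power xs≡p)

  prime-power : ∀ k .{{_ : NonZero k}} {p} → (∀ {r} → Prime r → r ∣ k → r ≡ p) → ∃[ a ] k ≡ p ^ a
  prime-power k only-p = length fs , trans k≡∏fs (product-≡-power (factors≡p fs ∣∏fs⇒∣k fs-prime))
    where
    open PrimeFactorisation (factorise k)
      renaming (factors to fs; isFactorisation to k≡∏fs; factorsPrime to fs-prime)
    ∣∏fs⇒∣k : ∀ {r} → r ∣ product fs → r ∣ k
    ∣∏fs⇒∣k = subst (_ ∣_) (sym k≡∏fs)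
    factors≡p : ∀ xs → (∀ {r} → r ∣ product xs → r ∣ k) → All Prime xs → All (_≡ _) xs
    factors≡p []       _    []                   = []
    factors≡p (x ∷ xs) ∣⇒∣k (x-prime ∷ xs-prime) =
      only-p x-prime (∣⇒∣k (m∣m*n (product xs))) ∷ factors≡p xs (∣⇒∣k ∘ flip ∣-trans (n∣m*n x)) xs-prime

  prime-divisor : ∀ k .{{_ : NonZero k}} → k ≢ 1 → ∃[ p ] Prime p × p ∣ k
  prime-divisor k k≢1 with factorise k
  ... | record { factors = [] ; isFactorisation = k≡1 } = ⊥-elim (k≢1 k≡1)
  ... | record { factors = p ∷ ps ; isFactorisation = k≡∏ ; factorsPrime = p-prime ∷ _ } =
    p , p-prime , subst (p ∣_) (sym k≡∏) (m∣m*n (product ps))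

  positive-exponent : ∀ {k p a} → k ≢ 1 → k ≡ p ^ a → 1 ≤ a
  positive-exponent {a = zero}  k≢1 k≡1 = ⊥-elim (k≢1 k≡1)
  positive-exponent {a = suc _} _   _   = s≤s z≤n

  common-prime-power : ∀ k m .{{_ : NonZero k}} .{{_ : NonZero m}} → k ≢ 1 → m ≢ 1 →
    (∀ {p q} → Prime p → p ∣ m → Prime q → q ∣ k → p ≡ q) →
    Σ ℕ λ p → Σ ℕ λ a → Σ ℕ λ b → Prime p × 1 ≤ a × 1 ≤ b × k ≡ p ^ a × m ≡ p ^ b
  common-prime-power k m k≢1 m≢1 agree with prime-divisor m m≢1 | prime-divisor k k≢1
  ... | p , p-prime , p∣m | q , q-prime , q∣k with prime-power k only-p-in-k | prime-power m only-p-in-m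
    where
    only-p-in-k : ∀ {r} → Prime r → r ∣ k → r ≡ p
    only-p-in-k r-prime r∣k = sym (agree p-prime p∣m r-prime r∣k)
    only-p-in-m : ∀ {r} → Prime r → r ∣ m → r ≡ p
    only-p-in-m r-prime r∣m = trans (agree r-prime r∣m q-prime q∣k) (sym (agree p-prime p∣m q-prime q∣k))
  ... | a , k≡pᵃ | b , m≡pᵇ =
    p , a , b , p-prime , positive-exponent k≢1 k≡pᵃ , positive-exponent m≢1 m≡pᵇ , k≡pᵃ , m≡pᵇ

open PrimePowers

module Game {n m : ℕ} .{{_ : NonZero m}} {S : List (Permutation′ n)} (id∈S : Any (λ g → id ≈ₚ g) S)
            (win : CanWin n m S) where

  open import Data.Nat using (_<_; s≤s; z≤n; nonTrivial⇒n>1)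
  open import Data.Nat.Properties using (≤-trans)
  open import Data.Nat.Divisibility using (_∣_; ∣⇒≤)
  open import Data.Nat.Primality using (prime⇒irreducible; ¬prime[1])
  open import Data.Integer using (+_; _-_)
  open import Data.Fin as Fin using (Fin; toℕ; fromℕ<)
  open import Data.Fin.Properties using (toℕ-fromℕ<)
  open import Data.List.Membership.Propositional using (find)
  open import Data.Product using (∃-syntax)
  open import Data.Empty using (⊥; ⊥-elim)
  open import Relation.Binary.PropositionalEquality
  open Iteration

  module _ {p : ℕ} (p-prime : Prime p) (p∣m : p ∣ m) where

    1<m : 1 < m
    1<m = ≤-trans (nonTrivial⇒n>1 p) (∣⇒≤ p∣m)

    0<m : 0 < m
    0<m = ≤-trans (s≤s z≤n) 1<m

    indicator : Fin n → Config n m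
    indicator x i with i Fin.≟ x
    ... | yes _ = fromℕ< 1<m
    ... | no  _ = fromℕ< 0<m

    indicator-jump : ∀ {x y} → y ≢ x → + toℕ (indicator x x) - + toℕ (indicator x y) ≡ + 1
    indicator-jump {x} {y} y≢x with x Fin.≟ x | y Fin.≟ x
    ... | no x≢x | _       = ⊥-elim (x≢x refl)
    ... | yes _  | yes y≡x = ⊥-elim (y≢x y≡x)
    ... | yes _  | no _    = cong₂ (λ a b → + a - + b) (toℕ-fromℕ< 1<m) (toℕ-fromℕ< 0<m)

    coprime-order⇒identity : ∀ {h} → Gen S h → ∀ {q} → (∀ i → iterate (h ⟨$⟩ʳ_) q i ≡ i) →
                             ¬ p ∣ q → ∀ x → h ⟨$⟩ʳ x ≡ x
    coprime-order⇒identity {h} h∈G period p∤q x with h ⟨$⟩ʳ x Fin.≟ x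
    ... | yes hx≡x = hx≡x
    ... | no  hx≢x = ⊥-elim (loses win (find id∈S))
      where
      open Filtration S p-prime
      -- flip h ⟨$⟩ˡ_ is h ⟨$⟩ʳ_ by definition.
      open CoprimeOrder (ginv h∈G) period p∤q
      loses : CanWin n m S → ∃[ g₀ ] g₀ ∈ S × id ≈ₚ g₀ → ⊥
      loses (L , ys , wins) (g₀ , g₀∈S , id≈g₀) =
        let c₀ , gs , gs∈S , _ , c₀-loses = adversary ys 0 (indicator x) (jump∉N L (indicator-jump hx≢x))
        in  c₀-loses (wins c₀ gs gs∈S)
        where open Adversary S p-prime p∣m g₀∈S (λ i → sym (id≈g₀ i))

  prime-divisors-agree : ∀ {k} → GenOrder S k → ∀ {p q} → Prime p → p ∣ m → Prime q → q ∣ k → p ≡ q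
  prime-divisors-agree (es , |es|≡k , es⊆⟨S⟩ , es-distinct , ⟨S⟩⊆es) {p} {q} p-prime p∣m q-prime q∣k
    with p ≟ q
  ... | yes p≡q = p≡q
  ... | no  p≢q =
    let a , period , nontrivial = cauchy q-prime (subst (q ∣_) (sym |es|≡k) q∣k)
    in  ⊥-elim (nontrivial (coprime-order⇒identity p-prime p∣m (E∈⟨S⟩ a) period p∤q))
    where
    open Cauchy es es⊆⟨S⟩ es-distinct ⟨S⟩⊆es
    p∤q : ¬ p ∣ q
    p∤q p∣q with prime⇒irreducible q-prime p∣q
    ... | inj₁ p≡1 = ¬prime[1] (subst Prime p≡1 p-prime)
    ... | inj₂ p≡q = p≢q p≡q

lemma6p2 : (n m : ℕ) → 1 ≤ n → .{{_ : NonZero m}} →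
    (S : List (Permutation′ n)) → Any (λ g → id ≈ₚ g) S →
    CanWin n m S →
    (k : ℕ) → GenOrder S k →
    k ≡ 1 ⊎ (m ≡ 1 ⊎
      Σ ℕ λ p → Σ ℕ λ a → Σ ℕ λ b →
        Prime p × 1 ≤ a × 1 ≤ b × k ≡ p ^ a × m ≡ p ^ b)
lemma6p2 n m _ S id∈S win k order@(es , |es|≡k , es⊆⟨S⟩ , es-distinct , ⟨S⟩⊆es) with k ≟ 1 | m ≟ 1
... | yes k≡1 | _       = inj₁ k≡1
... | no  _   | yes m≡1 = inj₂ (inj₁ m≡1)
... | no  k≢1 | no  m≢1 =
  inj₂ (inj₂ (common-prime-power k m {{k≢0}} k≢1 m≢1 (prime-divisors-agree order)))
  where
  open Game id∈S win
  k≢0 : NonZero k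
  k≢0 = subst NonZero |es|≡k (Cauchy.K-nonZero es es⊆⟨S⟩ es-distinct ⟨S⟩⊆es)
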